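{- For every $n\geq 0$ and every $P\in\mathcal{D}_n^{h,\geq}$, $$\#UDD(P)=\#FD(\phi(P))+\#UD(\phi(P))+\#FUU(\phi(P))+\#FUF(\phi(P)).$$
   Context: A Motzkin path of length $n$ is a word in the steps $U=(1,1)$, $D=(1,-1)$, $F=(1,0)$ forming a lattice path from $(0,0)$ to $(n,0)$ never going below the $x$-axis; $\mathcal{M}_n$ is the set of them. A Dyck path of semilength $n$ is a Motzkin path of length $2n$ without $F$ steps. Every nonempty Dyck path has a unique first return decomposition $P=U\alpha D\beta$ with $\alpha,\beta$ Dyck paths; $h$ denotes maximal height. $\mathcal{D}^{h,\geq}$ is defined recursively: it contains the empty path $\epsilon$, and $P=U\alpha D\beta$ belongs to it iff $\alpha,\beta\in\mathcal{D}^{h,\geq}$ and $h(U\alpha D)\geq h(\beta)$; $\mathcal{D}_n^{h,\geq}$ is the subset of semilength $n$. The bijection $\phi:\mathcal{D}_n^{h,\geq}\to\mathcal{M}_n$ is defined by $\phi(\epsilon)=\epsilon$, $\phi(\alpha UD)=\phi(\alpha)F$, $\phi(\alpha UU\beta D\gamma D)=\phi(\alpha)\phi(\gamma)U\phi(\beta)D$. For a word $X$, $\#X(P)$ is the number of occurrences of $X$ as consecutive steps in $P$. -}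

module Defs where

open import Data.Nat using (ℕ; zero; suc; _+_; _*_; _⊔_; _≥_)
open import Data.Bool using (Bool; true; false; _∧_)
open import Data.List using (List; []; _∷_; _++_; length)
open import Data.Maybe using (Maybe; just; nothing)
open import Data.Product using (_×_; _,_)

-- Steps of lattice paths: U = (1,1), D = (1,-1), F = (1,0).
data Step : Set where
  U D F : Step

Word : Set
Word = List Step

heightFrom : ℕ → Word → ℕ
heightFrom k []            = k
heightFrom k (U ∷ w)       = k ⊔ heightFrom (suc k) w
heightFrom k (F ∷ w)       = k ⊔ heightFrom k w
heightFrom zero (D ∷ w)    = heightFrom zero w
heightFrom (suc k) (D ∷ w) = suc k ⊔ heightFrom k w

h : Word → ℕ
h = heightFrom 0

-- Every member is a Dyck path, and the first return decomposition of a
-- Dyck path is unique, so this inductive predicate is exactly the paper's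
-- recursive definition.
data Dhge : Word → Set where
  eps  : Dhge []
  node : (α β : Word) → Dhge α → Dhge β →
         h (U ∷ α ++ D ∷ []) ≥ h β → Dhge (U ∷ α ++ D ∷ β)

DhgeN : ℕ → Word → Set
DhgeN n P = Dhge P × length P ≡ 2 * n
  where open import Relation.Binary.PropositionalEquality using (_≡_)

eqStep : Step → Step → Bool
eqStep U U = true
eqStep D D = true
eqStep F F = true
eqStep _ _ = false

isPrefix : Word → Word → Bool
isPrefix []      _       = true
isPrefix (_ ∷ _) []      = false
isPrefix (x ∷ X) (y ∷ P) = eqStep x y ∧ isPrefix X P

count : Word → Word → ℕ
count X []      = 0
count X (y ∷ P) = (if isPrefix X (y ∷ P) then 1 else 0) + count X P
  where open import Data.Bool using (if_then_else_)

-- Decomposition helpers (defined for Dyck words; return nothing otherwise).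
-- frFrom k w : reading w at depth k above the starting level, split off the
-- prefix up to the first D that brings the depth below 0.
frFrom : ℕ → Word → Maybe (Word × Word)
frFrom k [] = nothing
frFrom zero (D ∷ r) = just ([] , r)
frFrom (suc k) (D ∷ r) with frFrom k r
... | just (a , b) = just (D ∷ a , b)
... | nothing = nothing
frFrom k (U ∷ r) with frFrom (suc k) r
... | just (a , b) = just (U ∷ a , b)
... | nothing = nothing
frFrom k (F ∷ r) with frFrom k r
... | just (a , b) = just (F ∷ a , b)
... | nothing = nothing

-- First return decomposition: firstReturn (U α D β) = just (α , β).
firstReturn : Word → Maybe (Word × Word)
firstReturn (U ∷ r) = frFrom 0 r
firstReturn _       = nothing

-- Last return decomposition (with fuel): lastReturn (α U δ D) = just (α , δ),
-- where U δ D is the last prime component.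
lastReturnF : ℕ → Word → Maybe (Word × Word)
lastReturnF zero _ = nothing
lastReturnF (suc f) w with firstReturn w
... | nothing = nothing
... | just (a , []) = just ([] , a)
... | just (a , b@(_ ∷ _)) with lastReturnF f b
...   | nothing = nothing
...   | just (a' , d) = just (U ∷ a ++ D ∷ a' , d)

lastReturn : Word → Maybe (Word × Word)
lastReturn w = lastReturnF (length w) w

-- The bijection φ, following the paper's clauses literally:
--   φ(ε) = ε,  φ(α U D) = φ(α) F,  φ(α U U β D γ D) = φ(α) φ(γ) U φ(β) D.
-- Fuel = length; all recursive arguments are strictly shorter, so the fuel
-- never runs out on Dyck paths.
phiF : ℕ → Word → Word
phiF zero _ = []
phiF (suc f) [] = []
phiF (suc f) w@(_ ∷ _) with lastReturn w
... | nothing = []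
... | just (α , []) = phiF f α ++ F ∷ []
... | just (α , δ@(_ ∷ _)) with firstReturn δ
...   | nothing = []
...   | just (β , γ) = phiF f α ++ phiF f γ ++ U ∷ phiF f β ++ D ∷ []

φ : Word → Word
φ P = phiF (length P) P

-- Induct on the first return decomposition P = U α D β. The occurrences of UDD in P are
-- those of U α D and of β, and φ P = φ (U α D) φ β where φ (U α D) ends in D, so the
-- Motzkin statistic splits in the same way. For α = U β′ D γ′ with β′ nonempty, the UDD's
-- of U U β′ D γ′ D are those of β′ and γ′ plus one for each of β′, γ′ ending in UD, while
-- φ (U α D) = φ γ′ U φ β′ D gains, besides the patterns of φ γ′ and φ β′, one FD or
-- FUU/FUF for each of φ γ′, φ β′ ending in F; and φ w ends in F exactly when w ends in UD.
-- When the first component is a single peak (α or β′ empty), the height condition forces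
-- the path that follows it to be (UD)^k, and both sides are computed outright.

module Submission where

open import Defs
open import Data.Nat using (ℕ; zero; suc; s≤s⁻¹; _+_; _≤_; _<_; _≥_; z≤n; s≤s)
open import Data.Nat.Properties
open import Data.List using (List; []; _∷_; _++_; length; reverse; replicate; map)
open import Data.List.Relation.Unary.All using (All; []; _∷_)
open import Data.List.Properties
  using (++-assoc; ++-identityʳ; ∷-injective; length-++; length-++-≤ˡ; length-++-≤ʳ; reverse-++; length-reverse)
open import Data.Maybe using (just)
open import Data.Product using (_,_; proj₁; proj₂; ∃-syntax)
open import Algebra.Properties.CommutativeSemigroup +-commutativeSemigroup using (interchange)
open import Data.Empty using (⊥-elim)
open import Function using (_∘_)
open import Data.Bool using (Bool; _∧_; if_then_else_)
open import Relation.Binary.PropositionalEquality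
open import Data.Nat.Tactic.RingSolver using (solve-∀)

-- Dyck paths and their first and last return decompositions

data Dyck : Word → Set where
  ε    : Dyck []
  node : ∀ {α β} → Dyck α → Dyck β → Dyck (U ∷ α ++ D ∷ β)

Dhge⇒Dyck : ∀ {w} → Dhge w → Dyck w
Dhge⇒Dyck eps                = ε
Dhge⇒Dyck (node _ _ dα dβ _) = node (Dhge⇒Dyck dα) (Dhge⇒Dyck dβ)

Dyck-++ : ∀ {a b} → Dyck a → Dyck b → Dyck (a ++ b)
Dyck-++ ε db = db
Dyck-++ {b = b} (node {α} {β} dα dβ) db =
  subst Dyck (cong (U ∷_) (sym (++-assoc α (D ∷ β) b))) (node dα (Dyck-++ dβ db))

node-++ : ∀ β γ → (U ∷ β ++ D ∷ []) ++ γ ≡ U ∷ β ++ D ∷ γ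
node-++ β γ = cong (U ∷_) (++-assoc β (D ∷ []) γ)

data LastReturn : Word → Set where
  ε    : LastReturn []
  snoc : ∀ {α δ} → Dyck α → Dyck δ → LastReturn (α ++ U ∷ δ ++ D ∷ [])

lastReturnView : ∀ {w} → Dyck w → LastReturn w
lastReturnView ε = ε
lastReturnView (node {α} dα dβ) with lastReturnView dβ
... | ε                   = snoc ε dα
... | snoc {α′} {δ} dα′ dδ =
  subst LastReturn (cong (U ∷_) (++-assoc α (D ∷ α′) (U ∷ δ ++ D ∷ []))) (snoc (node dα dα′) dδ)

frFrom-U : ∀ k r {x y} → frFrom (suc k) r ≡ just (x , y) → frFrom k (U ∷ r) ≡ just (U ∷ x , y)
frFrom-U zero    r eq rewrite eq = refl
frFrom-U (suc k) r eq rewrite eq = refl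

frFrom-D : ∀ k r {x y} → frFrom k r ≡ just (x , y) → frFrom (suc k) (D ∷ r) ≡ just (D ∷ x , y)
frFrom-D k r eq rewrite eq = refl

frFrom-Dyck : ∀ {a} → Dyck a → ∀ k r {x y} → frFrom k r ≡ just (x , y) → frFrom k (a ++ r) ≡ just (a ++ x , y)
frFrom-Dyck ε k r eq = eq
frFrom-Dyck (node {α} {β} dα dβ) k r {x} eq
  rewrite ++-assoc α (D ∷ β) r | ++-assoc α (D ∷ β) x =
  frFrom-U k _ (frFrom-Dyck dα (suc k) (D ∷ β ++ r) (frFrom-D k (β ++ r) (frFrom-Dyck dβ k r eq)))

firstReturn-node : ∀ {α} → Dyck α → ∀ β → firstReturn (U ∷ α ++ D ∷ β) ≡ just (α , β)
firstReturn-node {α} dα β =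
  trans (frFrom-Dyck dα 0 (D ∷ β) refl) (cong (λ a → just (a , β)) (++-identityʳ α))

lastReturnF-step : ∀ f w {a b a′ d} → firstReturn w ≡ just (a , b) →
  lastReturnF f b ≡ just (a′ , d) → lastReturnF (suc f) w ≡ just (U ∷ a ++ D ∷ a′ , d)
lastReturnF-step zero    w {b = []}    _   ()
lastReturnF-step (suc f) w {b = []}    _   ()
lastReturnF-step f       w {b = _ ∷ _} eq₁ eq₂ rewrite eq₁ | eq₂ = refl

lastReturnF-snoc : ∀ {α δ} → Dyck α → Dyck δ → ∀ f → length α < f →
  lastReturnF f (α ++ U ∷ δ ++ D ∷ []) ≡ just (α , δ)
lastReturnF-snoc ε dδ (suc f) _ rewrite firstReturn-node dδ [] = refl
lastReturnF-snoc {δ = δ} (node {α} {β} dα dβ) dδ (suc f) (s≤s α<f)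
  rewrite ++-assoc α (D ∷ β) (U ∷ δ ++ D ∷ []) =
  lastReturnF-step f (U ∷ α ++ D ∷ β ++ U ∷ δ ++ D ∷ []) (firstReturn-node dα (β ++ U ∷ δ ++ D ∷ []))
    (lastReturnF-snoc dβ dδ f (≤-trans (length-++-≤ʳ (D ∷ β) {α}) (<⇒≤ α<f)))

length-snoc : ∀ α δ → length (α ++ U ∷ δ ++ D ∷ []) ≡ suc (length α + length (δ ++ D ∷ []))
length-snoc α δ = trans (length-++ α) (+-suc _ _)

lastReturn-snoc : ∀ {α δ} → Dyck α → Dyck δ → lastReturn (α ++ U ∷ δ ++ D ∷ []) ≡ just (α , δ)
lastReturn-snoc {α} {δ} dα dδ =
  lastReturnF-snoc dα dδ _ (subst (length α <_) (sym (length-snoc α δ)) (s≤s (m≤m+n _ _)))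

-- The recursive equations of φ on Dyck paths

phiF-[] : ∀ f → phiF f [] ≡ []
phiF-[] zero    = refl
phiF-[] (suc f) = refl

phiF-unfold-UUDD : ∀ f x xs {α y ys β γ} → lastReturn (x ∷ xs) ≡ just (α , y ∷ ys) →
  firstReturn (y ∷ ys) ≡ just (β , γ) →
  phiF (suc f) (x ∷ xs) ≡ phiF f α ++ phiF f γ ++ U ∷ phiF f β ++ D ∷ []
phiF-unfold-UUDD f x xs eq₁ eq₂ rewrite eq₁ | eq₂ = refl

phiF-αUD : ∀ {α} → Dyck α → ∀ f → phiF (suc f) (α ++ U ∷ D ∷ []) ≡ phiF f α ++ F ∷ []
phiF-αUD dα@ε          f rewrite lastReturn-snoc dα ε = refl
phiF-αUD dα@(node _ _) f rewrite lastReturn-snoc dα ε = refl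

phiF-αUUβDγD : ∀ {α β γ} → Dyck α → Dyck β → Dyck γ → ∀ f →
  phiF (suc f) (α ++ U ∷ U ∷ (β ++ D ∷ γ) ++ D ∷ []) ≡ phiF f α ++ phiF f γ ++ U ∷ phiF f β ++ D ∷ []
phiF-αUUβDγD {β = β} {γ} dα@ε dβ dγ f =
  phiF-unfold-UUDD f U (U ∷ (β ++ D ∷ γ) ++ D ∷ [])
    (lastReturn-snoc dα (node dβ dγ)) (firstReturn-node dβ γ)
phiF-αUUβDγD {β = β} {γ} dα@(node {a} {b} _ _) dβ dγ f =
  phiF-unfold-UUDD f U ((a ++ D ∷ b) ++ U ∷ U ∷ (β ++ D ∷ γ) ++ D ∷ [])
    (lastReturn-snoc dα (node dβ dγ)) (firstReturn-node dβ γ)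

length-node-≤ˡ : ∀ β γ → length β ≤ length (U ∷ β ++ D ∷ γ)
length-node-≤ˡ β γ = ≤-trans (length-++-≤ˡ β) (n≤1+n _)

length-node-≤ʳ : ∀ β γ → length γ ≤ length (U ∷ β ++ D ∷ γ)
length-node-≤ʳ β γ = ≤-trans (n≤1+n _) (≤-trans (length-++-≤ʳ (D ∷ γ) {β}) (n≤1+n _))

module _ (α δ : Word) {f : ℕ} (fuel : length (α ++ U ∷ δ ++ D ∷ []) ≤ f) where

  snoc-fuel : length α + length (δ ++ D ∷ []) < f
  snoc-fuel = subst (_≤ f) (length-snoc α δ) fuel

module _ (α δ : Word) {f : ℕ} (fuel : length (α ++ U ∷ δ ++ D ∷ []) ≤ suc f) where

  snoc-fuelˡ : length α ≤ f
  snoc-fuelˡ = m+n≤o⇒m≤o _ (s≤s⁻¹ (snoc-fuel α δ fuel))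

  snoc-fuelʳ : length δ ≤ f
  snoc-fuelʳ = ≤-trans (length-++-≤ˡ δ) (m+n≤o⇒n≤o _ (s≤s⁻¹ (snoc-fuel α δ fuel)))

phiF-fuel-irrelevant : ∀ f g {w} → Dyck w → length w ≤ f → length w ≤ g → phiF f w ≡ phiF g w
phiF-fuel-irrelevant f g dw lf lg with lastReturnView dw
... | ε = trans (phiF-[] f) (sym (phiF-[] g))
phiF-fuel-irrelevant zero g dw lf lg | snoc {α} {δ} _ _ = ⊥-elim (n≮0 (snoc-fuel α δ lf))
phiF-fuel-irrelevant (suc f) zero dw lf lg | snoc {α} {δ} _ _ = ⊥-elim (n≮0 (snoc-fuel α δ lg))
phiF-fuel-irrelevant (suc f) (suc g) dw lf lg | snoc {α} dα ε = begin
  phiF (suc f) (α ++ U ∷ D ∷ []) ≡⟨ phiF-αUD dα f ⟩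
  phiF f α ++ F ∷ []
    ≡⟨ cong (_++ F ∷ []) (phiF-fuel-irrelevant f g dα (snoc-fuelˡ α [] lf) (snoc-fuelˡ α [] lg)) ⟩
  phiF g α ++ F ∷ []              ≡⟨ phiF-αUD dα g ⟨
  phiF (suc g) (α ++ U ∷ D ∷ []) ∎
  where open ≡-Reasoning
phiF-fuel-irrelevant (suc f) (suc g) dw lf lg | snoc {α} dα (node {β} {γ} dβ dγ) = begin
  phiF (suc f) w                                  ≡⟨ phiF-αUUβDγD dα dβ dγ f ⟩
  phiF f α ++ phiF f γ ++ U ∷ phiF f β ++ D ∷ []  ≡⟨ cong₂ _++_ (fuel dα (snoc-fuelˡ α δ))
                                                       (cong₂ (λ x y → x ++ U ∷ y ++ D ∷ [])
                                                         (fuel dγ (≤-trans (length-node-≤ʳ β γ) ∘ snoc-fuelʳ α δ))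
                                                         (fuel dβ (≤-trans (length-node-≤ˡ β γ) ∘ snoc-fuelʳ α δ))) ⟩
  phiF g α ++ phiF g γ ++ U ∷ phiF g β ++ D ∷ []  ≡⟨ phiF-αUUβDγD dα dβ dγ g ⟨
  phiF (suc g) w                                  ∎
  where
  open ≡-Reasoning
  δ = U ∷ β ++ D ∷ γ
  w = α ++ U ∷ δ ++ D ∷ []
  fuel : ∀ {v} → Dyck v → (∀ {k} → length w ≤ suc k → length v ≤ k) → phiF f v ≡ phiF g v
  fuel dv bound = phiF-fuel-irrelevant f g dv (bound lf) (bound lg)

φ-fuel : ∀ {w f} → Dyck w → length w ≤ f → phiF f w ≡ φ w
φ-fuel dw l = phiF-fuel-irrelevant _ _ dw l ≤-refl

φ-αUD : ∀ {α} → Dyck α → φ (α ++ U ∷ D ∷ []) ≡ φ α ++ F ∷ []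
φ-αUD {α} dα = begin
  φ (α ++ U ∷ D ∷ [])              ≡⟨ cong (λ k → phiF k (α ++ U ∷ D ∷ [])) (length-snoc α []) ⟩
  phiF (suc n) (α ++ U ∷ D ∷ [])   ≡⟨ phiF-αUD dα n ⟩
  phiF n α ++ F ∷ []               ≡⟨ cong (_++ F ∷ []) (φ-fuel dα (snoc-fuelˡ α [] (≤-reflexive (length-snoc α [])))) ⟩
  φ α ++ F ∷ []                    ∎
  where
  open ≡-Reasoning
  n = length α + length (D ∷ [])

φ-αUUβDγD : ∀ {α β γ} → Dyck α → Dyck β → Dyck γ →
  φ (α ++ U ∷ U ∷ (β ++ D ∷ γ) ++ D ∷ []) ≡ φ α ++ φ γ ++ U ∷ φ β ++ D ∷ []
φ-αUUβDγD {α} {β} {γ} dα dβ dγ = begin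
  φ w                                             ≡⟨ cong (λ k → phiF k w) (length-snoc α δ) ⟩
  phiF (suc n) w                                  ≡⟨ phiF-αUUβDγD dα dβ dγ n ⟩
  phiF n α ++ phiF n γ ++ U ∷ phiF n β ++ D ∷ []  ≡⟨ cong₂ _++_ (φ-fuel dα (snoc-fuelˡ α δ fuel))
                                                       (cong₂ (λ x y → x ++ U ∷ y ++ D ∷ [])
                                                         (φ-fuel dγ (≤-trans (length-node-≤ʳ β γ) (snoc-fuelʳ α δ fuel)))
                                                         (φ-fuel dβ (≤-trans (length-node-≤ˡ β γ) (snoc-fuelʳ α δ fuel)))) ⟩
  φ α ++ φ γ ++ U ∷ φ β ++ D ∷ []                 ∎
  where
  open ≡-Reasoning
  δ = U ∷ β ++ D ∷ γ
  w = α ++ U ∷ δ ++ D ∷ []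
  n = length α + length (δ ++ D ∷ [])
  fuel : length w ≤ suc n
  fuel = ≤-reflexive (length-snoc α δ)

φ-snoc : ∀ {α δ} → Dyck α → Dyck δ → φ (α ++ U ∷ δ ++ D ∷ []) ≡ φ α ++ φ (U ∷ δ ++ D ∷ [])
φ-snoc {α} dα ε            = trans (φ-αUD dα) (cong (φ α ++_) (sym (φ-αUD ε)))
φ-snoc {α} dα (node dβ dγ) = trans (φ-αUUβDγD dα dβ dγ) (cong (φ α ++_) (sym (φ-αUUβDγD ε dβ dγ)))

φ-++ : ∀ {a b} → Dyck a → Dyck b → φ (a ++ b) ≡ φ a ++ φ b
φ-++ {a} da ε = trans (cong φ (++-identityʳ a)) (sym (++-identityʳ (φ a)))
φ-++ {a} da (node {β} {γ} dβ dγ) = begin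
  φ (a ++ U ∷ β ++ D ∷ γ)                       ≡⟨ cong φ (sym (trans (++-assoc a _ γ) (cong (a ++_) (node-++ β γ)))) ⟩
  φ ((a ++ U ∷ β ++ D ∷ []) ++ γ)               ≡⟨ φ-++ (Dyck-++ da (node dβ ε)) dγ ⟩
  φ (a ++ U ∷ β ++ D ∷ []) ++ φ γ               ≡⟨ cong (_++ φ γ) (φ-snoc da dβ) ⟩
  (φ a ++ φ (U ∷ β ++ D ∷ [])) ++ φ γ           ≡⟨ ++-assoc (φ a) _ (φ γ) ⟩
  φ a ++ φ (U ∷ β ++ D ∷ []) ++ φ γ             ≡⟨ cong (φ a ++_) (φ-++ (node dβ ε) dγ) ⟨
  φ a ++ φ ((U ∷ β ++ D ∷ []) ++ γ)             ≡⟨ cong (λ v → φ a ++ φ v) (node-++ β γ) ⟩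
  φ a ++ φ (U ∷ β ++ D ∷ γ)                     ∎
  where open ≡-Reasoning

-- Counting consecutive patterns

𝟙 : Bool → ℕ
𝟙 b = if b then 1 else 0

isPrefix-++ : ∀ X u v → length X ≤ length u → isPrefix X (u ++ v) ≡ isPrefix X u
isPrefix-++ []      u       v _       = refl
isPrefix-++ (x ∷ X) (y ∷ u) v (s≤s l) = cong (eqStep x y ∧_) (isPrefix-++ X u v l)

-- Inclusion–exclusion over the window x ∷ l: an occurrence of a pattern of length at most 3
-- starting two or more steps before the window cannot reach b, so only the step just before
-- the window has to be checked.
count-window : ∀ X → length X ≤ 3 → ∀ a x l b →
  (∀ z → isPrefix X (z ∷ x ∷ l ++ b) ≡ isPrefix X (z ∷ x ∷ l)) →
  count X (a ++ x ∷ l ++ b) + count X (x ∷ l) ≡ count X (a ++ x ∷ l) + count X (x ∷ l ++ b)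
count-window X _ [] x l b _ = +-comm (count X (x ∷ l ++ b)) (count X (x ∷ l))
count-window X short (z ∷ a) x l b near = begin
  𝟙 (isPrefix X (z ∷ a ++ x ∷ l ++ b)) + count X (a ++ x ∷ l ++ b) + count X (x ∷ l)
    ≡⟨ +-assoc (𝟙 (isPrefix X (z ∷ a ++ x ∷ l ++ b))) _ _ ⟩
  𝟙 (isPrefix X (z ∷ a ++ x ∷ l ++ b)) + (count X (a ++ x ∷ l ++ b) + count X (x ∷ l))
    ≡⟨ cong₂ _+_ (cong 𝟙 (start a)) (count-window X short a x l b near) ⟩
  𝟙 (isPrefix X (z ∷ a ++ x ∷ l)) + (count X (a ++ x ∷ l) + count X (x ∷ l ++ b))
    ≡⟨ +-assoc (𝟙 (isPrefix X (z ∷ a ++ x ∷ l))) _ _ ⟨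
  𝟙 (isPrefix X (z ∷ a ++ x ∷ l)) + count X (a ++ x ∷ l) + count X (x ∷ l ++ b) ∎
  where
  open ≡-Reasoning
  start : ∀ a → isPrefix X (z ∷ a ++ x ∷ l ++ b) ≡ isPrefix X (z ∷ a ++ x ∷ l)
  start []      = near z
  start (y ∷ a) = begin
    isPrefix X (z ∷ y ∷ a ++ x ∷ l ++ b)   ≡⟨ cong (λ v → isPrefix X (z ∷ y ∷ v)) (++-assoc a (x ∷ l) b) ⟨
    isPrefix X ((z ∷ y ∷ a ++ x ∷ l) ++ b) ≡⟨ isPrefix-++ X _ b (≤-trans short (s≤s (s≤s long))) ⟩
    isPrefix X (z ∷ y ∷ a ++ x ∷ l)        ∎
    where
    long : 1 ≤ length (a ++ x ∷ l)
    long = ≤-trans (s≤s z≤n) (length-++-≤ʳ (x ∷ l) {a})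

countAll : List Word → Word → ℕ
countAll []       w = 0
countAll (X ∷ Xs) w = count X w + countAll Xs w

prefixCount : List Word → Word → ℕ
prefixCount []       w = 0
prefixCount (X ∷ Xs) w = 𝟙 (isPrefix X w) + prefixCount Xs w

countAll-∷ : ∀ Xs y w → countAll Xs (y ∷ w) ≡ prefixCount Xs (y ∷ w) + countAll Xs w
countAll-∷ []       y w = refl
countAll-∷ (X ∷ Xs) y w =
  trans (cong (count X (y ∷ w) +_) (countAll-∷ Xs y w)) (interchange (𝟙 (isPrefix X (y ∷ w))) _ _ _)

countAll-window : ∀ Xs → All (λ X → length X ≤ 3) Xs → ∀ a x l b →
  (∀ z → map (λ X → isPrefix X (z ∷ x ∷ l ++ b)) Xs ≡ map (λ X → isPrefix X (z ∷ x ∷ l)) Xs) →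
  countAll Xs (a ++ x ∷ l ++ b) + countAll Xs (x ∷ l) ≡ countAll Xs (a ++ x ∷ l) + countAll Xs (x ∷ l ++ b)
countAll-window []       []               a x l b near = refl
countAll-window (X ∷ Xs) (short ∷ shorts) a x l b near = begin
  (count X (a ++ x ∷ l ++ b) + countAll Xs (a ++ x ∷ l ++ b)) + (count X (x ∷ l) + countAll Xs (x ∷ l))
    ≡⟨ interchange (count X (a ++ x ∷ l ++ b)) _ _ _ ⟩
  (count X (a ++ x ∷ l ++ b) + count X (x ∷ l)) + (countAll Xs (a ++ x ∷ l ++ b) + countAll Xs (x ∷ l))
    ≡⟨ cong₂ _+_ (count-window X short a x l b (proj₁ ∘ ∷-injective ∘ near))
                 (countAll-window Xs shorts a x l b (proj₂ ∘ ∷-injective ∘ near)) ⟩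
  (count X (a ++ x ∷ l) + count X (x ∷ l ++ b)) + (countAll Xs (a ++ x ∷ l) + countAll Xs (x ∷ l ++ b))
    ≡⟨ interchange (count X (a ++ x ∷ l)) _ _ _ ⟩
  (count X (a ++ x ∷ l) + countAll Xs (a ++ x ∷ l)) + (count X (x ∷ l ++ b) + countAll Xs (x ∷ l ++ b)) ∎
  where open ≡-Reasoning

endsWith : Word → Word → ℕ
endsWith s w = 𝟙 (isPrefix (reverse s) (reverse w))

endsWith-++ : ∀ s w t → length s ≤ length t → endsWith s (w ++ t) ≡ endsWith s t
endsWith-++ s w t l = cong 𝟙 (begin
  isPrefix (reverse s) (reverse (w ++ t))          ≡⟨ cong (isPrefix (reverse s)) (reverse-++ w t) ⟩
  isPrefix (reverse s) (reverse t ++ reverse w)    ≡⟨ isPrefix-++ (reverse s) (reverse t) (reverse w) bound ⟩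
  isPrefix (reverse s) (reverse t)                 ∎)
  where
  open ≡-Reasoning
  bound : length (reverse s) ≤ length (reverse t)
  bound = subst₂ _≤_ (sym (length-reverse s)) (sym (length-reverse t)) l

data DyckEnding : Word → Set where
  ε    : DyckEnding []
  _·UD : ∀ a → DyckEnding (a ++ U ∷ D ∷ [])
  _·DD : ∀ a → DyckEnding (a ++ D ∷ D ∷ [])

DγD-ends-DD : ∀ {γ} → Dyck γ → ∃[ p ] D ∷ γ ++ D ∷ [] ≡ p ++ D ∷ D ∷ []
DγD-ends-DD ε = [] , refl
DγD-ends-DD (node {α} {β} _ dβ) with DγD-ends-DD dβ
... | p , eq = D ∷ U ∷ α ++ p , cong (D ∷_) (cong (U ∷_) (begin
  (α ++ D ∷ β) ++ D ∷ []     ≡⟨ ++-assoc α (D ∷ β) (D ∷ []) ⟩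
  α ++ D ∷ β ++ D ∷ []       ≡⟨ cong (α ++_) eq ⟩
  α ++ p ++ D ∷ D ∷ []       ≡⟨ ++-assoc α p (D ∷ D ∷ []) ⟨
  (α ++ p) ++ D ∷ D ∷ []     ∎))
  where open ≡-Reasoning

αUUβDγD-ends-DD : ∀ α β {γ} → Dyck γ → ∃[ p ] α ++ U ∷ U ∷ (β ++ D ∷ γ) ++ D ∷ [] ≡ p ++ D ∷ D ∷ []
αUUβDγD-ends-DD α β {γ} dγ with DγD-ends-DD dγ
... | p , eq = α ++ U ∷ U ∷ β ++ p , (begin
  α ++ U ∷ U ∷ (β ++ D ∷ γ) ++ D ∷ []   ≡⟨ cong (λ v → α ++ U ∷ U ∷ v) (++-assoc β (D ∷ γ) (D ∷ [])) ⟩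
  α ++ U ∷ U ∷ β ++ D ∷ γ ++ D ∷ []     ≡⟨ cong (λ v → α ++ U ∷ U ∷ β ++ v) eq ⟩
  α ++ U ∷ U ∷ β ++ p ++ D ∷ D ∷ []     ≡⟨ cong (λ v → α ++ U ∷ U ∷ v) (++-assoc β p (D ∷ D ∷ [])) ⟨
  α ++ (U ∷ U ∷ β ++ p) ++ D ∷ D ∷ []   ≡⟨ ++-assoc α (U ∷ U ∷ β ++ p) (D ∷ D ∷ []) ⟨
  (α ++ U ∷ U ∷ β ++ p) ++ D ∷ D ∷ []   ∎)
  where open ≡-Reasoning

dyckEnding : ∀ {w} → Dyck w → DyckEnding w
dyckEnding dw with lastReturnView dw
... | ε = ε
... | snoc {α} _ ε = α ·UD
... | snoc {α} _ (node {β} dβ dγ) with αUUβDγD-ends-DD α β dγ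
...   | p , eq = subst DyckEnding (sym eq) (p ·DD)

#UDD : Word → ℕ
#UDD = count (U ∷ D ∷ D ∷ [])

#UDD-window : ∀ a x l b →
  (∀ z → isPrefix (U ∷ D ∷ D ∷ []) (z ∷ x ∷ l ++ b) ≡ isPrefix (U ∷ D ∷ D ∷ []) (z ∷ x ∷ l)) →
  #UDD (a ++ x ∷ l ++ b) + #UDD (x ∷ l) ≡ #UDD (a ++ x ∷ l) + #UDD (x ∷ l ++ b)
#UDD-window = count-window (U ∷ D ∷ D ∷ []) ≤-refl

#UDD-split : ∀ a {β} → Dyck β → #UDD (a ++ D ∷ β) ≡ #UDD (a ++ D ∷ []) + #UDD β
#UDD-split a ε            = sym (+-identityʳ _)
#UDD-split a (node _ _) = trans (sym (+-identityʳ _)) (#UDD-window a D [] _ λ _ → refl)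

#UDD-∷ʳD : ∀ {w} → DyckEnding w → ∀ R → #UDD (w ++ D ∷ R) ≡ #UDD w + endsWith (U ∷ D ∷ []) w + #UDD R
#UDD-∷ʳD ε       R = refl
#UDD-∷ʳD (a ·UD) R = begin
  #UDD ((a ++ U ∷ D ∷ []) ++ D ∷ R)                  ≡⟨ cong #UDD (++-assoc a (U ∷ D ∷ []) (D ∷ R)) ⟩
  #UDD (a ++ U ∷ D ∷ D ∷ R)                          ≡⟨ +-identityʳ _ ⟨
  #UDD (a ++ U ∷ D ∷ D ∷ R) + 0                      ≡⟨ #UDD-window a U (D ∷ []) (D ∷ R) (λ _ → refl) ⟩
  #UDD (a ++ U ∷ D ∷ []) + (1 + #UDD R)              ≡⟨ +-assoc _ 1 _ ⟨
  #UDD (a ++ U ∷ D ∷ []) + 1 + #UDD R                ≡⟨ cong (λ e → #UDD (a ++ U ∷ D ∷ []) + e + #UDD R)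
                                                          (endsWith-++ (U ∷ D ∷ []) a (U ∷ D ∷ []) ≤-refl) ⟨
  #UDD (a ++ U ∷ D ∷ []) + endsWith (U ∷ D ∷ []) (a ++ U ∷ D ∷ []) + #UDD R ∎
  where open ≡-Reasoning
#UDD-∷ʳD (a ·DD) R = begin
  #UDD ((a ++ D ∷ D ∷ []) ++ D ∷ R)                  ≡⟨ cong #UDD (++-assoc a (D ∷ D ∷ []) (D ∷ R)) ⟩
  #UDD (a ++ D ∷ D ∷ D ∷ R)                          ≡⟨ +-identityʳ _ ⟨
  #UDD (a ++ D ∷ D ∷ D ∷ R) + 0                      ≡⟨ #UDD-window a D (D ∷ []) (D ∷ R) (λ _ → refl) ⟩
  #UDD (a ++ D ∷ D ∷ []) + #UDD R                    ≡⟨ cong (_+ #UDD R) (+-identityʳ _) ⟨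
  #UDD (a ++ D ∷ D ∷ []) + 0 + #UDD R                ≡⟨ cong (λ e → #UDD (a ++ D ∷ D ∷ []) + e + #UDD R)
                                                          (endsWith-++ (U ∷ D ∷ []) a (D ∷ D ∷ []) ≤-refl) ⟨
  #UDD (a ++ D ∷ D ∷ []) + endsWith (U ∷ D ∷ []) (a ++ D ∷ D ∷ []) + #UDD R ∎
  where open ≡-Reasoning

#UDD-peak : ∀ {β γ} → Dyck β → Dyck γ → β ≢ [] →
  #UDD (U ∷ U ∷ (β ++ D ∷ γ) ++ D ∷ [])
    ≡ (#UDD β + endsWith (U ∷ D ∷ []) β) + (#UDD γ + endsWith (U ∷ D ∷ []) γ)
#UDD-peak ε _ β≢[] = ⊥-elim (β≢[] refl)
#UDD-peak {β} {γ} dβ@(node _ _) dγ _ = begin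
  #UDD ((β ++ D ∷ γ) ++ D ∷ [])                     ≡⟨ cong #UDD (++-assoc β (D ∷ γ) (D ∷ [])) ⟩
  #UDD (β ++ D ∷ γ ++ D ∷ [])                       ≡⟨ #UDD-∷ʳD (dyckEnding dβ) (γ ++ D ∷ []) ⟩
  #UDD β + endsWith (U ∷ D ∷ []) β + #UDD (γ ++ D ∷ [])
    ≡⟨ cong (#UDD β + endsWith (U ∷ D ∷ []) β +_) (trans (#UDD-∷ʳD (dyckEnding dγ) []) (+-identityʳ _)) ⟩
  #UDD β + endsWith (U ∷ D ∷ []) β + (#UDD γ + endsWith (U ∷ D ∷ []) γ) ∎
  where open ≡-Reasoning

data FDEnding : Word → Set where
  ε   : FDEnding []
  _·F : ∀ a → FDEnding (a ++ F ∷ [])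
  _·D : ∀ a → FDEnding (a ++ D ∷ [])

data StartsUF : Word → Set where
  U∷_ : ∀ r → StartsUF (U ∷ r)
  F∷_ : ∀ r → StartsUF (F ∷ r)

StartsUF-++ : ∀ {a} → StartsUF a → ∀ b → StartsUF (a ++ b)
StartsUF-++ (U∷ r) b = U∷ (r ++ b)
StartsUF-++ (F∷ r) b = F∷ (r ++ b)

φγUβD-assoc : ∀ a c b → a ++ c ++ U ∷ b ++ D ∷ [] ≡ (a ++ c ++ U ∷ b) ++ D ∷ []
φγUβD-assoc a c b =
  sym (trans (++-assoc a (c ++ U ∷ b) (D ∷ [])) (cong (a ++_) (++-assoc c (U ∷ b) (D ∷ []))))

φ-ending : ∀ {w} → Dyck w → FDEnding (φ w)
φ-ending dw with lastReturnView dw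
... | ε = ε
... | snoc {α} dα ε = subst FDEnding (sym (φ-αUD dα)) (φ α ·F)
... | snoc {α} dα (node {β} {γ} dβ dγ) =
  subst FDEnding (sym (trans (φ-αUUβDγD dα dβ dγ) (φγUβD-assoc (φ α) (φ γ) (φ β)))) ((φ α ++ φ γ ++ U ∷ φ β) ·D)

φ-endsWith-F : ∀ {w} → Dyck w → endsWith (F ∷ []) (φ w) ≡ endsWith (U ∷ D ∷ []) w
φ-endsWith-F dw with lastReturnView dw
... | ε = refl
... | snoc {α} dα ε = begin
  endsWith (F ∷ []) (φ (α ++ U ∷ D ∷ []))  ≡⟨ cong (endsWith (F ∷ [])) (φ-αUD dα) ⟩
  endsWith (F ∷ []) (φ α ++ F ∷ [])        ≡⟨ endsWith-++ (F ∷ []) (φ α) (F ∷ []) ≤-refl ⟩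
  1                                        ≡⟨ endsWith-++ (U ∷ D ∷ []) α (U ∷ D ∷ []) ≤-refl ⟨
  endsWith (U ∷ D ∷ []) (α ++ U ∷ D ∷ [])  ∎
  where open ≡-Reasoning
... | snoc {α} dα (node {β} {γ} dβ dγ) with αUUβDγD-ends-DD α β dγ
...   | p , eq = begin
  endsWith (F ∷ []) (φ (α ++ U ∷ U ∷ (β ++ D ∷ γ) ++ D ∷ []))
    ≡⟨ cong (endsWith (F ∷ [])) (trans (φ-αUUβDγD dα dβ dγ) (φγUβD-assoc (φ α) (φ γ) (φ β))) ⟩
  endsWith (F ∷ []) ((φ α ++ φ γ ++ U ∷ φ β) ++ D ∷ [])
    ≡⟨ endsWith-++ (F ∷ []) (φ α ++ φ γ ++ U ∷ φ β) (D ∷ []) ≤-refl ⟩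
  0 ≡⟨ endsWith-++ (U ∷ D ∷ []) p (D ∷ D ∷ []) ≤-refl ⟨
  endsWith (U ∷ D ∷ []) (p ++ D ∷ D ∷ []) ≡⟨ cong (endsWith (U ∷ D ∷ [])) eq ⟨
  endsWith (U ∷ D ∷ []) (α ++ U ∷ U ∷ (β ++ D ∷ γ) ++ D ∷ []) ∎
  where open ≡-Reasoning

φ-node-startsUF : ∀ {α β} → Dyck α → Dyck β → StartsUF (φ (U ∷ α ++ D ∷ β))
φ∷U-startsUF : ∀ {γ} → Dyck γ → ∀ r → StartsUF (φ γ ++ U ∷ r)

φ-node-startsUF {α} {β} dα dβ =
  subst StartsUF (trans (sym (φ-++ (node dα ε) dβ)) (cong φ (node-++ α β))) (StartsUF-++ (prime dα) (φ β))
  where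
  prime : ∀ {α} → Dyck α → StartsUF (φ (U ∷ α ++ D ∷ []))
  prime ε                        = F∷ []
  prime (node {β′} {γ′} dβ′ dγ′) = subst StartsUF (sym (φ-αUUβDγD ε dβ′ dγ′)) (φ∷U-startsUF dγ′ _)

φ∷U-startsUF ε            r = U∷ r
φ∷U-startsUF (node dα dβ) r = StartsUF-++ (φ-node-startsUF dα dβ) (U ∷ r)

motzkinPatterns : List Word
motzkinPatterns = (F ∷ D ∷ []) ∷ (U ∷ D ∷ []) ∷ (F ∷ U ∷ U ∷ []) ∷ (F ∷ U ∷ F ∷ []) ∷ []

#M : Word → ℕ
#M = countAll motzkinPatterns

#M-window : ∀ a x l b →
  (∀ z → map (λ X → isPrefix X (z ∷ x ∷ l ++ b)) motzkinPatterns
       ≡ map (λ X → isPrefix X (z ∷ x ∷ l)) motzkinPatterns) →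
  #M (a ++ x ∷ l ++ b) + #M (x ∷ l) ≡ #M (a ++ x ∷ l) + #M (x ∷ l ++ b)
#M-window = countAll-window motzkinPatterns (s≤s (s≤s z≤n) ∷ s≤s (s≤s z≤n) ∷ ≤-refl ∷ ≤-refl ∷ [])

#M-split : ∀ a b → #M ((a ++ D ∷ []) ++ b) ≡ #M (a ++ D ∷ []) + #M b
#M-split a b = begin
  #M ((a ++ D ∷ []) ++ b)          ≡⟨ cong #M (++-assoc a (D ∷ []) b) ⟩
  #M (a ++ D ∷ b)                  ≡⟨ +-identityʳ _ ⟨
  #M (a ++ D ∷ b) + 0              ≡⟨ #M-window a D [] b (λ _ → refl) ⟩
  #M (a ++ D ∷ []) + #M b ∎
  where open ≡-Reasoning

#M-∷ʳD : ∀ {B} → FDEnding B → #M (B ++ D ∷ []) ≡ #M B + endsWith (F ∷ []) B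
#M-∷ʳD ε = refl
#M-∷ʳD (a ·F) = begin
  #M ((a ++ F ∷ []) ++ D ∷ [])      ≡⟨ cong #M (++-assoc a (F ∷ []) (D ∷ [])) ⟩
  #M (a ++ F ∷ D ∷ [])              ≡⟨ +-identityʳ _ ⟨
  #M (a ++ F ∷ D ∷ []) + 0          ≡⟨ #M-window a F [] (D ∷ []) (λ _ → refl) ⟩
  #M (a ++ F ∷ []) + 1              ≡⟨ cong (#M (a ++ F ∷ []) +_) (endsWith-++ (F ∷ []) a (F ∷ []) ≤-refl) ⟨
  #M (a ++ F ∷ []) + endsWith (F ∷ []) (a ++ F ∷ []) ∎
  where open ≡-Reasoning
#M-∷ʳD (a ·D) = begin
  #M ((a ++ D ∷ []) ++ D ∷ [])      ≡⟨ #M-split a (D ∷ []) ⟩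
  #M (a ++ D ∷ []) + 0              ≡⟨ cong (#M (a ++ D ∷ []) +_) (endsWith-++ (F ∷ []) a (D ∷ []) ≤-refl) ⟨
  #M (a ++ D ∷ []) + endsWith (F ∷ []) (a ++ D ∷ []) ∎
  where open ≡-Reasoning

#M-U∷ : ∀ {r} → StartsUF r → #M (U ∷ r) ≡ #M r
#M-U∷ (U∷ _) = refl
#M-U∷ (F∷ _) = refl

#M-FU∷ : ∀ {r} → StartsUF r → #M (F ∷ U ∷ r) ≡ 1 + #M r
#M-FU∷ (U∷ r) = countAll-∷ motzkinPatterns F (U ∷ U ∷ r)
#M-FU∷ (F∷ r) = countAll-∷ motzkinPatterns F (U ∷ F ∷ r)

#M-++U : ∀ {A r} → FDEnding A → StartsUF r →
  #M (A ++ U ∷ r) ≡ #M A + endsWith (F ∷ []) A + #M r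
#M-++U ε sr = #M-U∷ sr
#M-++U {r = r} (a ·F) sr = begin
  #M ((a ++ F ∷ []) ++ U ∷ r)            ≡⟨ cong #M (++-assoc a (F ∷ []) (U ∷ r)) ⟩
  #M (a ++ F ∷ U ∷ r)                    ≡⟨ +-identityʳ _ ⟨
  #M (a ++ F ∷ U ∷ r) + 0                ≡⟨ #M-window a F [] (U ∷ r) (λ _ → refl) ⟩
  #M (a ++ F ∷ []) + #M (F ∷ U ∷ r)
    ≡⟨ cong (#M (a ++ F ∷ []) +_) (#M-FU∷ sr) ⟩
  #M (a ++ F ∷ []) + (1 + #M r)
    ≡⟨ +-assoc _ 1 _ ⟨
  #M (a ++ F ∷ []) + 1 + #M r
    ≡⟨ cong (λ e → #M (a ++ F ∷ []) + e + #M r) (endsWith-++ (F ∷ []) a (F ∷ []) ≤-refl) ⟨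
  #M (a ++ F ∷ []) + endsWith (F ∷ []) (a ++ F ∷ []) + #M r ∎
  where open ≡-Reasoning
#M-++U {r = r} (a ·D) sr = begin
  #M ((a ++ D ∷ []) ++ U ∷ r)            ≡⟨ #M-split a (U ∷ r) ⟩
  #M (a ++ D ∷ []) + #M (U ∷ r)
    ≡⟨ cong (#M (a ++ D ∷ []) +_) (#M-U∷ sr) ⟩
  #M (a ++ D ∷ []) + #M r
    ≡⟨ cong (_+ #M r) (+-identityʳ (#M (a ++ D ∷ []))) ⟨
  #M (a ++ D ∷ []) + 0 + #M r
    ≡⟨ cong (λ e → #M (a ++ D ∷ []) + e + #M r) (endsWith-++ (F ∷ []) a (D ∷ []) ≤-refl) ⟨
  #M (a ++ D ∷ []) + endsWith (F ∷ []) (a ++ D ∷ []) + #M r ∎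
  where open ≡-Reasoning

#M-peak : ∀ {A B} → FDEnding A → StartsUF B → FDEnding B →
  #M (A ++ U ∷ B ++ D ∷ [])
    ≡ (#M A + endsWith (F ∷ []) A) + (#M B + endsWith (F ∷ []) B)
#M-peak {A} eA sB eB =
  trans (#M-++U eA (StartsUF-++ sB (D ∷ []))) (cong (#M A + endsWith (F ∷ []) A +_) (#M-∷ʳD eB))

#M-φ-split : ∀ {α β} → Dyck α → Dyck β → α ≢ [] →
  #M (φ (U ∷ α ++ D ∷ β)) ≡ #M (φ (U ∷ α ++ D ∷ [])) + #M (φ β)
#M-φ-split ε _ α≢[] = ⊥-elim (α≢[] refl)
#M-φ-split {β = β} (node {β₁} {γ₁} dβ₁ dγ₁) dβ _ = begin
  #M (φ (U ∷ α ++ D ∷ β))                         ≡⟨ cong #M (trans (cong φ (sym (node-++ α β))) (φ-++ (node dα ε) dβ)) ⟩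
  #M (φ (U ∷ α ++ D ∷ []) ++ φ β)                 ≡⟨ cong (λ v → #M (v ++ φ β)) φUαD ⟩
  #M (((φ γ₁ ++ U ∷ φ β₁) ++ D ∷ []) ++ φ β)      ≡⟨ #M-split (φ γ₁ ++ U ∷ φ β₁) (φ β) ⟩
  #M ((φ γ₁ ++ U ∷ φ β₁) ++ D ∷ []) + #M (φ β)  ≡⟨ cong (λ v → #M v + #M (φ β)) φUαD ⟨
  #M (φ (U ∷ α ++ D ∷ [])) + #M (φ β) ∎
  where
  open ≡-Reasoning
  α = U ∷ β₁ ++ D ∷ γ₁
  dα = node dβ₁ dγ₁
  φUαD : φ (U ∷ α ++ D ∷ []) ≡ (φ γ₁ ++ U ∷ φ β₁) ++ D ∷ []
  φUαD = trans (φ-αUUβDγD ε dβ₁ dγ₁) (sym (++-assoc (φ γ₁) (U ∷ φ β₁) (D ∷ [])))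

-- Paths of height at most one

peaks : ℕ → Word
peaks zero    = []
peaks (suc k) = U ∷ D ∷ peaks k

heightFrom-≥ : ∀ k w → k ≤ heightFrom k w
heightFrom-≥ k       []      = ≤-refl
heightFrom-≥ k       (U ∷ w) = m≤m⊔n k (heightFrom (suc k) w)
heightFrom-≥ k       (F ∷ w) = m≤m⊔n k (heightFrom k w)
heightFrom-≥ zero    (D ∷ w) = z≤n
heightFrom-≥ (suc k) (D ∷ w) = m≤m⊔n (suc k) (heightFrom k w)

low-peaks : ∀ {γ} → Dhge γ → h γ ≤ 1 → ∃[ k ] γ ≡ peaks k
low-peaks eps _ = 0 , refl
low-peaks (node .[] β eps dβ h≥) _ with low-peaks dβ h≥
... | k , refl = suc k , refl
low-peaks (node _ β (node β′ γ′ _ _ _) _ _) h≤1 =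
  ⊥-elim (<-irrefl refl (≤-trans (heightFrom-≥ 2 r) (≤-trans (m≤n⊔m 1 _) h≤1)))
  where r = (β′ ++ D ∷ γ′) ++ D ∷ β

Dyck-peaks : ∀ k → Dyck (peaks k)
Dyck-peaks zero    = ε
Dyck-peaks (suc k) = node ε (Dyck-peaks k)

φ-peaks : ∀ k → φ (peaks k) ≡ replicate k F
φ-peaks zero    = refl
φ-peaks (suc k) = trans (φ-++ (node ε ε) (Dyck-peaks k)) (cong (F ∷_) (φ-peaks k))

#UDD-peaks : ∀ k → #UDD (peaks k) ≡ 0
#UDD-peaks zero          = refl
#UDD-peaks (suc zero)    = refl
#UDD-peaks (suc (suc k)) = #UDD-peaks (suc k)

#UDD-UDpeaksD : ∀ k → #UDD (U ∷ D ∷ peaks k ++ D ∷ []) ≡ 1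
#UDD-UDpeaksD zero    = refl
#UDD-UDpeaksD (suc k) = #UDD-UDpeaksD k

#M-Fs : ∀ k → #M (replicate k F) ≡ 0
#M-Fs zero          = refl
#M-Fs (suc zero)    = refl
#M-Fs (suc (suc k)) = #M-Fs (suc k)

#M-FsUD : ∀ k → #M (replicate k F ++ U ∷ D ∷ []) ≡ 1
#M-FsUD zero          = refl
#M-FsUD (suc zero)    = refl
#M-FsUD (suc (suc k)) = #M-FsUD (suc k)

#UDD≡#M∘φ : ∀ {P} → Dhge P → #UDD P ≡ #M (φ P)
#UDD≡#M∘φ-UUβDγD : ∀ {β γ} → Dhge β → Dhge γ → h (U ∷ β ++ D ∷ []) ≥ h γ →
  #UDD (U ∷ U ∷ (β ++ D ∷ γ) ++ D ∷ []) ≡ #M (φ (U ∷ U ∷ (β ++ D ∷ γ) ++ D ∷ []))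

#UDD≡#M∘φ eps = refl
#UDD≡#M∘φ (node .[] β eps dβ h≥) with low-peaks dβ h≥
... | k , refl = begin
  #UDD (peaks (suc k))      ≡⟨ #UDD-peaks (suc k) ⟩
  0                         ≡⟨ #M-Fs (suc k) ⟨
  #M (replicate (suc k) F)  ≡⟨ cong #M (φ-peaks (suc k)) ⟨
  #M (φ (peaks (suc k)))    ∎
  where open ≡-Reasoning
#UDD≡#M∘φ (node α β dα@(node β₁ γ₁ dβ₁ dγ₁ h₁) dβ _) = begin
  #UDD (U ∷ α ++ D ∷ β)                ≡⟨ #UDD-split (U ∷ α) (Dhge⇒Dyck dβ) ⟩
  #UDD (U ∷ α ++ D ∷ []) + #UDD β      ≡⟨ cong₂ _+_ (#UDD≡#M∘φ-UUβDγD dβ₁ dγ₁ h₁) (#UDD≡#M∘φ dβ) ⟩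
  #M (φ (U ∷ α ++ D ∷ [])) + #M (φ β)  ≡⟨ #M-φ-split (Dhge⇒Dyck dα) (Dhge⇒Dyck dβ) (λ ()) ⟨
  #M (φ (U ∷ α ++ D ∷ β))              ∎
  where open ≡-Reasoning

#UDD≡#M∘φ-UUβDγD {γ = γ} eps dγ h≥ with low-peaks dγ h≥
... | k , refl = begin
  #UDD (U ∷ D ∷ peaks k ++ D ∷ [])       ≡⟨ #UDD-UDpeaksD k ⟩
  1                                      ≡⟨ #M-FsUD k ⟨
  #M (replicate k F ++ U ∷ D ∷ [])       ≡⟨ cong (λ v → #M (v ++ U ∷ D ∷ [])) (φ-peaks k) ⟨
  #M (φ (peaks k) ++ U ∷ D ∷ [])         ≡⟨ cong #M (φ-αUUβDγD ε ε (Dyck-peaks k)) ⟨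
  #M (φ (U ∷ U ∷ D ∷ peaks k ++ D ∷ []))  ∎
  where open ≡-Reasoning
#UDD≡#M∘φ-UUβDγD {β} {γ} dβ@(node _ _ dβ₁ dβ₂ _) dγ _ = begin
  #UDD (U ∷ U ∷ (β ++ D ∷ γ) ++ D ∷ [])
    ≡⟨ #UDD-peak yβ yγ (λ ()) ⟩
  (#UDD β + endsWith (U ∷ D ∷ []) β) + (#UDD γ + endsWith (U ∷ D ∷ []) γ)
    ≡⟨ cong₂ _+_ (cong₂ _+_ (#UDD≡#M∘φ dβ) (sym (φ-endsWith-F yβ)))
                 (cong₂ _+_ (#UDD≡#M∘φ dγ) (sym (φ-endsWith-F yγ))) ⟩
  (#M (φ β) + endsWith (F ∷ []) (φ β)) + (#M (φ γ) + endsWith (F ∷ []) (φ γ))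
    ≡⟨ +-comm (#M (φ β) + endsWith (F ∷ []) (φ β)) _ ⟩
  (#M (φ γ) + endsWith (F ∷ []) (φ γ)) + (#M (φ β) + endsWith (F ∷ []) (φ β))
    ≡⟨ #M-peak (φ-ending yγ) (φ-node-startsUF (Dhge⇒Dyck dβ₁) (Dhge⇒Dyck dβ₂)) (φ-ending yβ) ⟨
  #M (φ γ ++ U ∷ φ β ++ D ∷ [])
    ≡⟨ cong #M (φ-αUUβDγD ε yβ yγ) ⟨
  #M (φ (U ∷ U ∷ (β ++ D ∷ γ) ++ D ∷ [])) ∎
  where
  open ≡-Reasoning
  yβ = Dhge⇒Dyck dβ
  yγ = Dhge⇒Dyck dγ

#M-unfold : ∀ w → #M w
  ≡ count (F ∷ D ∷ []) w + count (U ∷ D ∷ []) w + count (F ∷ U ∷ U ∷ []) w + count (F ∷ U ∷ F ∷ []) w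
#M-unfold w =
  regroup (count (F ∷ D ∷ []) w) (count (U ∷ D ∷ []) w) (count (F ∷ U ∷ U ∷ []) w) (count (F ∷ U ∷ F ∷ []) w)
  where
  regroup : ∀ a b c d → a + (b + (c + (d + 0))) ≡ a + b + c + d
  regroup = solve-∀

theorem9 : (n : ℕ) (P : Word) → DhgeN n P →
    count (U ∷ D ∷ D ∷ []) P
      ≡ count (F ∷ D ∷ []) (φ P) + count (U ∷ D ∷ []) (φ P)
        + count (F ∷ U ∷ U ∷ []) (φ P) + count (F ∷ U ∷ F ∷ []) (φ P)
theorem9 _ P (dP , _) = trans (#UDD≡#M∘φ dP) (#M-unfold (φ P))
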